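{- Let $b$ be a positive integer and $y_1,y_2$ integers with $0\le y_1<2b$, $0<y_2<2b$, $\gcd\{b,y_1,y_2\}=1$, and $|y_1-y_2|=b$. Then in $L(b;1,y_1;1,y_2)$, for all $(x,y)\in\mathbb{N}^2$, \[\mathcal{SG}(x,y)=2\,(x \bmod 2)+\varepsilon(y),\quad\text{where } \varepsilon(y)=0 \text{ if } (y\bmod 2b)<b \text{ and } \varepsilon(y)=1 \text{ otherwise}.\] In particular the horizontal period is $2$. Moreover, the game does not have diagonal periodicity unless $y_1+y_2=2b$.
   Context: The Lengyel transfer game $L(b;x_1,y_1;x_2,y_2)$ is the impartial normal-play game on positions $(x,y)\in\mathbb{N}^2$ in which a move consists of adding one of $(0,-b)$, $(-x_1,y_1)$, $(-x_2,y_2)$, provided the result lies in $\mathbb{N}^2$; $\mathcal{SG}(x,y)$ is the Sprague–Grundy value. Let $\mathcal{SG}^*(x,y)=\mathcal{SG}(x,y)$ if $\mathcal{SG}(x,y)\in\{0,1,2\}$ and $\mathcal{SG}^*(x,y)=2$ if $\mathcal{SG}(x,y)=3$. The game has diagonal periodicity if for all $(x,y)$ with $y\ge y_1+y_2$, $\mathcal{SG}^*(x,y)=\mathcal{SG}^*(x+x_1+x_2,\,y-y_1-y_2)$. -}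

module Defs where

open import Data.Nat using (ℕ; zero; suc; _+_; _*_; _∸_; _<_; _≤ᵇ_; _≡ᵇ_; NonZero)
open import Data.Nat.Properties using (m*n≢0)
open import Data.Nat.DivMod using (_%_)
open import Data.Bool using (Bool; true; false; if_then_else_)
open import Data.List using (List; []; _∷_; _++_; length)
open import Relation.Binary.PropositionalEquality using (_≡_)
open import Relation.Nullary using (yes; no)

elemᵇ : ℕ → List ℕ → Bool
elemᵇ n []       = false
elemᵇ n (m ∷ ms) = if n ≡ᵇ m then true else elemᵇ n ms

-- mex: least natural number not occurring in the list.
-- mexFrom f n l searches n, n+1, ... ; with fuel  suc (length l)  the
-- search always terminates at the true minimum excluded value.
mexFrom : ℕ → ℕ → List ℕ → ℕ
mexFrom zero    n l = n
mexFrom (suc f) n l = if elemᵇ n l then mexFrom f (suc n) l else n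

mex : List ℕ → ℕ
mex l = mexFrom (suc (length l)) 0 l

-- Moves from (x,y):  (x, y - b) if y ≥ b;  (x-1, y+y1) and (x-1, y+y2) if x ≥ 1.
-- Sprague–Grundy value, computed column by column (x), and inside a column
-- by recursion on y (via the downward move (0,-b)), with fuel y+1, which is
-- sufficient when b ≥ 1.
-- 'side y' is the list of SG values of the options of (x,y) in column x-1.
column : (b : ℕ) → (ℕ → List ℕ) → ℕ → ℕ → ℕ
column b side zero    y = 0
column b side (suc n) y =
  mex ((if b ≤ᵇ y then column b side n (y ∸ b) ∷ [] else []) ++ side y)

SG : (b y₁ y₂ : ℕ) → ℕ → ℕ → ℕ
SG b y₁ y₂ zero    y = column b (λ _ → []) (suc y) y
SG b y₁ y₂ (suc x) y =
  column b (λ z → SG b y₁ y₂ x (z + y₁) ∷ SG b y₁ y₂ x (z + y₂) ∷ []) (suc y) y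

SG* : (b y₁ y₂ : ℕ) → ℕ → ℕ → ℕ
SG* b y₁ y₂ x y with SG b y₁ y₂ x y
... | 3 = 2
... | v = v

-- diagonal periodicity of L(b;1,y1;1,y2)  (x1 + x2 = 2)
DiagonalPeriodic : (b y₁ y₂ : ℕ) → Set
DiagonalPeriodic b y₁ y₂ =
  ∀ x y → y₁ + y₂ Data.Nat.≤ y →
    SG* b y₁ y₂ x y ≡ SG* b y₁ y₂ (x + 2) (y ∸ (y₁ + y₂))

ε : (b : ℕ) → .{{NonZero b}} → ℕ → ℕ
ε b y with Data.Nat._<?_ (_%_ y (2 * b) {{m*n≢0 2 b}}) b
... | yes _ = 0
... | no  _ = 1

{-# OPTIONS --safe #-}
-- ε flips under y ↦ y + b.  So the downward option (x, y - b) of (x, y) lies in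
-- the same parity class of columns with the opposite ε, and, since y₁ and y₂
-- differ by b, the two transfer options in column x - 1 carry both values 2p and
-- 2p + 1 of the other parity p.  A mex computation therefore propagates
-- SG(x, y) = 2 (x mod 2) + ε(y) from column to column.  Columns 0 and 2 both
-- read ε, so diagonal periodicity would make y₁ + y₂ ∈ (0, 4b) a period of ε,
-- and the only such period is 2b.
module Submission where

open import Defs
open import Data.Nat
open import Data.Nat.Properties
open import Data.Nat.DivMod
open import Data.Nat.GCD using (gcd)
open import Data.Bool using (true; false; if_then_else_)
open import Data.Empty using (⊥-elim)
open import Data.List using (List; []; _∷_; _++_)
open import Data.Product using (_×_; _,_)
open import Data.Sum using (_⊎_; inj₁; inj₂)
open import Relation.Binary.Definitions using (tri<; tri≈; tri>)
open import Relation.Binary.PropositionalEquality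
open import Relation.Nullary using (yes; no; ¬_; contradiction)
open import Relation.Nullary.Reflects using (ofʸ; ofⁿ)
open ≡-Reasoning

%2≤1 : ∀ x → x % 2 ≤ 1
%2≤1 x = m<1+n⇒m≤n (m%n<n x 2)

[1+x]%2≡1∸x%2 : ∀ x → suc x % 2 ≡ 1 ∸ x % 2
[1+x]%2≡1∸x%2 zero          = refl
[1+x]%2≡1∸x%2 (suc zero)    = refl
[1+x]%2≡1∸x%2 (suc (suc x)) = [1+x]%2≡1∸x%2 x

mex-single : ∀ {d e} → d ≤ 1 → e ≡ 1 ∸ d → mex (d ∷ []) ≡ e
mex-single z≤n       refl = refl
mex-single (s≤s z≤n) refl = refl

mex-pair : ∀ {p q a c e} → p ≤ 1 → a ≤ 1 → q ≡ 1 ∸ p → c ≡ 1 ∸ a → e ≡ 0 →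
           mex (2 * p + a ∷ 2 * p + c ∷ []) ≡ 2 * q + e
mex-pair z≤n       z≤n       refl refl refl = refl
mex-pair z≤n       (s≤s z≤n) refl refl refl = refl
mex-pair (s≤s z≤n) z≤n       refl refl refl = refl
mex-pair (s≤s z≤n) (s≤s z≤n) refl refl refl = refl

mex-triple : ∀ {p q a c d e} → p ≤ 1 → d ≤ 1 → a ≤ 1 →
             q ≡ 1 ∸ p → c ≡ 1 ∸ a → e ≡ 1 ∸ d →
             mex (2 * q + d ∷ 2 * p + a ∷ 2 * p + c ∷ []) ≡ 2 * q + e
mex-triple z≤n       z≤n       z≤n       refl refl refl = refl
mex-triple z≤n       z≤n       (s≤s z≤n) refl refl refl = refl
mex-triple z≤n       (s≤s z≤n) z≤n       refl refl refl = refl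
mex-triple z≤n       (s≤s z≤n) (s≤s z≤n) refl refl refl = refl
mex-triple (s≤s z≤n) z≤n       z≤n       refl refl refl = refl
mex-triple (s≤s z≤n) z≤n       (s≤s z≤n) refl refl refl = refl
mex-triple (s≤s z≤n) (s≤s z≤n) z≤n       refl refl refl = refl
mex-triple (s≤s z≤n) (s≤s z≤n) (s≤s z≤n) refl refl refl = refl

downOption : ℕ → (ℕ → ℕ) → ℕ → List ℕ
downOption b F y = if b ≤ᵇ y then F (y ∸ b) ∷ [] else []

downOption-cong : ∀ b {F G : ℕ → ℕ} y → (b ≤ y → F (y ∸ b) ≡ G (y ∸ b)) →
                  downOption b F y ≡ downOption b G y
downOption-cong b y eq with b ≤ᵇ y | ≤ᵇ-reflects-≤ b y
... | true  | ofʸ b≤y = cong (_∷ []) (eq b≤y)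
... | false | ofⁿ _   = refl

column-≡ : ∀ {b} .{{_ : NonZero b}} (side : ℕ → List ℕ) (F : ℕ → ℕ) →
           (∀ y → mex (downOption b F y ++ side y) ≡ F y) →
           ∀ {n y} → y < n → column b side n y ≡ F y
column-≡ {b} side F rec {suc n} {y} (s≤s y≤n) = begin
  mex (downOption b (column b side n) y ++ side y)
    ≡⟨ cong (λ o → mex (o ++ side y)) (downOption-cong b {column b side n} {F} y below) ⟩
  mex (downOption b F y ++ side y)
    ≡⟨ rec y ⟩
  F y ∎
  where
  below : b ≤ y → column b side n (y ∸ b) ≡ F (y ∸ b)
  below b≤y = column-≡ side F rec (<-≤-trans (∸-monoʳ-< (>-nonZero⁻¹ b) b≤y) y≤n)

SG*-≡ : ∀ b y₁ y₂ x y {v} → SG b y₁ y₂ x y ≡ v → v ≤ 1 → SG* b y₁ y₂ x y ≡ v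
SG*-≡ b y₁ y₂ x y eq v≤1 with SG b y₁ y₂ x y
SG*-≡ b y₁ y₂ x y refl z≤n       | .0 = refl
SG*-≡ b y₁ y₂ x y refl (s≤s z≤n) | .1 = refl

module _ (b : ℕ) .{{_ : NonZero b}} where

  private instance
    2b≢0 : NonZero (2 * b)
    2b≢0 = m*n≢0 2 b

  2b≡b+b : 2 * b ≡ b + b
  2b≡b+b = cong (b +_) (+-identityʳ b)

  b<2b : b < 2 * b
  b<2b = subst (b <_) (sym 2b≡b+b) (m<m+n b (>-nonZero⁻¹ b))

  ε≡0 : ∀ {y} → y % (2 * b) < b → ε b y ≡ 0
  ε≡0 {y} r<b with y % (2 * b) <? b
  ... | yes _   = refl
  ... | no  r≮b = contradiction r<b r≮b

  ε≡1 : ∀ {y} → b ≤ y % (2 * b) → ε b y ≡ 1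
  ε≡1 {y} b≤r with y % (2 * b) <? b
  ... | yes r<b = contradiction b≤r (<⇒≱ r<b)
  ... | no  _   = refl

  ε≤1 : ∀ {y} → ε b y ≤ 1
  ε≤1 {y} with y % (2 * b) <? b
  ... | yes _ = z≤n
  ... | no  _ = s≤s z≤n

  ε-cong-% : ∀ {y z} → y % (2 * b) ≡ z % (2 * b) → ε b y ≡ ε b z
  ε-cong-% {y} {z} eq with b ≤? z % (2 * b)
  ... | yes b≤r = trans (ε≡1 (subst (b ≤_) (sym eq) b≤r)) (sym (ε≡1 b≤r))
  ... | no  b≰r = trans (ε≡0 (subst (_< b) (sym eq) (≰⇒> b≰r))) (sym (ε≡0 (≰⇒> b≰r)))

  ε-<b : ∀ {y} → y < b → ε b y ≡ 0
  ε-<b {y} y<b = ε≡0 (subst (_< b) (sym (m<n⇒m%n≡m (<-trans y<b b<2b))) y<b)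

  ε-≥b-<2b : ∀ {y} → b ≤ y → y < 2 * b → ε b y ≡ 1
  ε-≥b-<2b {y} b≤y y<2b = ε≡1 (subst (b ≤_) (sym (m<n⇒m%n≡m y<2b)) b≤y)

  ε-+2b : ∀ y → ε b (y + 2 * b) ≡ ε b y
  ε-+2b y = ε-cong-% ([m+n]%n≡m%n y (2 * b))

  ε-%-+ : ∀ y k → ε b (y % (2 * b) + k) ≡ ε b (y + k)
  ε-%-+ y k = ε-cong-% (begin
    (y % (2 * b) + k) % (2 * b)
      ≡⟨ %-distribˡ-+ (y % (2 * b)) k (2 * b) ⟩
    (y % (2 * b) % (2 * b) + k % (2 * b)) % (2 * b)
      ≡⟨ cong (λ r → (r + k % (2 * b)) % (2 * b)) (m%n%n≡m%n y (2 * b)) ⟩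
    (y % (2 * b) + k % (2 * b)) % (2 * b)
      ≡⟨ %-distribˡ-+ y k (2 * b) ⟨
    (y + k) % (2 * b) ∎)

  ε-+b-below-2b : ∀ {r} → r < 2 * b → ε b (r + b) ≡ 1 ∸ ε b r
  ε-+b-below-2b {r} r<2b with r <? b
  ... | yes r<b = begin
    ε b (r + b) ≡⟨ ε-≥b-<2b (m≤n+m b r) (subst (r + b <_) (sym 2b≡b+b) (+-monoˡ-< b r<b)) ⟩
    1           ≡⟨ cong (1 ∸_) (ε-<b r<b) ⟨
    1 ∸ ε b r   ∎
  ... | no r≮b = begin
    ε b (r + b)               ≡⟨ cong (ε b) r+b≡r∸b+2b ⟩
    ε b (r ∸ b + 2 * b)       ≡⟨ ε-+2b (r ∸ b) ⟩
    ε b (r ∸ b)               ≡⟨ ε-<b (m<n+o⇒m∸n<o r b (subst (r <_) 2b≡b+b r<2b)) ⟩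
    0                         ≡⟨ cong (1 ∸_) (ε-≥b-<2b b≤r r<2b) ⟨
    1 ∸ ε b r                 ∎
    where
    b≤r : b ≤ r
    b≤r = ≮⇒≥ r≮b
    r+b≡r∸b+2b : r + b ≡ r ∸ b + 2 * b
    r+b≡r∸b+2b = begin
      r + b             ≡⟨ cong (_+ b) (m∸n+n≡m b≤r) ⟨
      r ∸ b + b + b     ≡⟨ +-assoc (r ∸ b) b b ⟩
      r ∸ b + (b + b)   ≡⟨ cong (r ∸ b +_) 2b≡b+b ⟨
      r ∸ b + 2 * b     ∎

  ε-+b : ∀ y → ε b (y + b) ≡ 1 ∸ ε b y
  ε-+b y = begin
    ε b (y + b)                 ≡⟨ ε-%-+ y b ⟨
    ε b (y % (2 * b) + b)       ≡⟨ ε-+b-below-2b (m%n<n y (2 * b)) ⟩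
    1 ∸ ε b (y % (2 * b))       ≡⟨ cong (1 ∸_) (ε-cong-% (m%n%n≡m%n y (2 * b))) ⟩
    1 ∸ ε b y                   ∎

  ε-∸b : ∀ {y} → b ≤ y → ε b y ≡ 1 ∸ ε b (y ∸ b)
  ε-∸b {y} b≤y = trans (cong (ε b) (sym (m∸n+n≡m b≤y))) (ε-+b (y ∸ b))

  ε-opposite : ∀ {u v} z → v ≡ u + b → ε b (z + v) ≡ 1 ∸ ε b (z + u)
  ε-opposite {u} z refl = trans (cong (ε b) (sym (+-assoc z u b))) (ε-+b (z + u))

  ε-flip : ∀ {y z} → ε b z ≡ 1 ∸ ε b y → ε b y ≡ 1 ∸ ε b z
  ε-flip eq = sym (trans (cong (1 ∸_) eq) (m∸[m∸n]≡n ε≤1))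

  ε-transfer-options : ∀ {y₁ y₂} → y₁ ≡ y₂ + b ⊎ y₂ ≡ y₁ + b →
                       ∀ z → ε b (z + y₂) ≡ 1 ∸ ε b (z + y₁)
  ε-transfer-options (inj₁ y₁≡y₂+b) z = ε-flip (ε-opposite z y₁≡y₂+b)
  ε-transfer-options (inj₂ y₂≡y₁+b) z = ε-opposite z y₂≡y₁+b

  ε-Period : ℕ → Set
  ε-Period s = ∀ t → ε b (t + s) ≡ ε b t

  ε-period-∸2b : ∀ {s} → ε-Period s → 2 * b ≤ s → ε-Period (s ∸ 2 * b)
  ε-period-∸2b {s} per 2b≤s t = begin
    ε b (t + (s ∸ 2 * b))           ≡⟨ ε-+2b (t + (s ∸ 2 * b)) ⟨
    ε b (t + (s ∸ 2 * b) + 2 * b)   ≡⟨ cong (ε b) (+-assoc t (s ∸ 2 * b) (2 * b)) ⟩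
    ε b (t + (s ∸ 2 * b + 2 * b))   ≡⟨ cong (λ k → ε b (t + k)) (m∸n+n≡m 2b≤s) ⟩
    ε b (t + s)                     ≡⟨ per t ⟩
    ε b t                           ∎

  ε-no-period-<2b : ∀ {s} → 0 < s → s < 2 * b → ¬ ε-Period s
  ε-no-period-<2b {s} 0<s s<2b per with s ≤? b
  ... | yes s≤b = 1+n≢0 (begin
    1                   ≡⟨ ε-≥b-<2b ≤-refl b<2b ⟨
    ε b b               ≡⟨ cong (ε b) (m∸n+n≡m s≤b) ⟨
    ε b (b ∸ s + s)     ≡⟨ per (b ∸ s) ⟩
    ε b (b ∸ s)         ≡⟨ ε-<b (∸-monoʳ-< 0<s s≤b) ⟩
    0                   ∎)
  ... | no s≰b = 1+n≢0 (begin
    1      ≡⟨ ε-≥b-<2b (<⇒≤ (≰⇒> s≰b)) s<2b ⟨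
    ε b s  ≡⟨ per 0 ⟩
    ε b 0  ≡⟨ ε-<b (>-nonZero⁻¹ b) ⟩
    0      ∎)

  ε-period⇒≡2b : ∀ {s} → 0 < s → s < 2 * b + 2 * b → ε-Period s → s ≡ 2 * b
  ε-period⇒≡2b {s} 0<s s<4b per with <-cmp s (2 * b)
  ... | tri< s<2b _ _ = ⊥-elim (ε-no-period-<2b 0<s s<2b per)
  ... | tri≈ _ s≡2b _ = s≡2b
  ... | tri> _ _ s>2b = ⊥-elim (ε-no-period-<2b (m<n⇒0<n∸m s>2b) (m<n+o⇒m∸n<o s (2 * b) s<4b)
                                                (ε-period-∸2b per (<⇒≤ s>2b)))

  sg : ℕ → ℕ → ℕ
  sg x y = 2 * (x % 2) + ε b y

  sg-column₀ : ∀ y → mex (downOption b (ε b) y ++ []) ≡ ε b y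
  sg-column₀ y with b ≤ᵇ y | ≤ᵇ-reflects-≤ b y
  ... | true  | ofʸ b≤y = mex-single ε≤1 (ε-∸b b≤y)
  ... | false | ofⁿ b≰y = sym (ε-<b (≰⇒> b≰y))

  module _ {y₁ y₂ : ℕ} (transfer : y₁ ≡ y₂ + b ⊎ y₂ ≡ y₁ + b) where

    sg-column-step : ∀ x z →
      mex (downOption b (sg (suc x)) z ++ (sg x (z + y₁) ∷ sg x (z + y₂) ∷ [])) ≡ sg (suc x) z
    sg-column-step x z with b ≤ᵇ z | ≤ᵇ-reflects-≤ b z
    ... | true  | ofʸ b≤z = mex-triple (%2≤1 x) ε≤1 ε≤1 ([1+x]%2≡1∸x%2 x) opposite (ε-∸b b≤z)
      where opposite = ε-transfer-options transfer z
    ... | false | ofⁿ b≰z = mex-pair (%2≤1 x) ε≤1 ([1+x]%2≡1∸x%2 x) opposite (ε-<b (≰⇒> b≰z))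
      where opposite = ε-transfer-options transfer z

    SG≡sg : ∀ x y → SG b y₁ y₂ x y ≡ sg x y
    SG≡sg zero    y = column-≡ (λ _ → []) (ε b) sg-column₀ (n<1+n y)
    SG≡sg (suc x) y = column-≡ _ (sg (suc x)) step (n<1+n y)
      where
      step : ∀ z → mex (downOption b (sg (suc x)) z ++
                        (SG b y₁ y₂ x (z + y₁) ∷ SG b y₁ y₂ x (z + y₂) ∷ []))
                   ≡ sg (suc x) z
      step z rewrite SG≡sg x (z + y₁) | SG≡sg x (z + y₂) = sg-column-step x z

    SG-period-2 : ∀ x y → SG b y₁ y₂ (x + 2) y ≡ SG b y₁ y₂ x y
    SG-period-2 x y = begin
      SG b y₁ y₂ (x + 2) y       ≡⟨ SG≡sg (x + 2) y ⟩
      2 * ((x + 2) % 2) + ε b y  ≡⟨ cong (λ p → 2 * p + ε b y) ([m+n]%n≡m%n x 2) ⟩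
      2 * (x % 2) + ε b y        ≡⟨ SG≡sg x y ⟨
      SG b y₁ y₂ x y             ∎

    diagonalPeriodic⇒ε-period : DiagonalPeriodic b y₁ y₂ → ε-Period (y₁ + y₂)
    diagonalPeriodic⇒ε-period diag t = begin
      ε b (t + s)                ≡⟨ SG*-≡ b y₁ y₂ 0 (t + s) (SG≡sg 0 (t + s)) ε≤1 ⟨
      SG* b y₁ y₂ 0 (t + s)      ≡⟨ diag 0 (t + s) (m≤n+m s t) ⟩
      SG* b y₁ y₂ 2 (t + s ∸ s)  ≡⟨ SG*-≡ b y₁ y₂ 2 (t + s ∸ s) (SG≡sg 2 (t + s ∸ s)) ε≤1 ⟩
      ε b (t + s ∸ s)            ≡⟨ cong (ε b) (m+n∸n≡m t s) ⟩
      ε b t                      ∎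
      where
      s = y₁ + y₂

mainTheorem11 : (b y₁ y₂ : ℕ) → .{{_ : NonZero b}} →
    y₁ < 2 * b → 0 < y₂ → y₂ < 2 * b →
    gcd b (gcd y₁ y₂) ≡ 1 →
    (y₁ ≡ y₂ + b ⊎ y₂ ≡ y₁ + b) →
    ((∀ x y → SG b y₁ y₂ x y ≡ 2 * (x % 2) + ε b y)
      × (∀ x y → SG b y₁ y₂ (x + 2) y ≡ SG b y₁ y₂ x y)
      × (DiagonalPeriodic b y₁ y₂ → y₁ + y₂ ≡ 2 * b))
mainTheorem11 b y₁ y₂ y₁<2b 0<y₂ y₂<2b _ transfer =
    SG≡sg b transfer
  , SG-period-2 b transfer
  , λ diag → ε-period⇒≡2b b 0<y₁+y₂ (+-mono-< y₁<2b y₂<2b)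
                            (diagonalPeriodic⇒ε-period b transfer diag)
  where
  0<y₁+y₂ : 0 < y₁ + y₂
  0<y₁+y₂ = <-≤-trans 0<y₂ (m≤n+m y₂ y₁)
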